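{- Let $V\subseteq\mathbb{Z}_2^n$ be a linear subspace of dimension $d$ with $n-2\le d\le n$, and suppose that for each $i\in\{1,\dots,n\}$ the coordinate projection $\pi_i:V\to\mathbb{Z}_2$ is surjective. Then there exist $\mathbf x,\mathbf y\in V$ such that $(\pi_i(\mathbf x),\pi_i(\mathbf y))\ne(0,0)$ for every $i\in\{1,\dots,n\}$. -}

module Defs where

open import Data.Bool using (Bool; true; false; _xor_)
open import Data.Nat using (ℕ)
open import Data.Vec using (Vec; []; _∷_; zipWith; replicate)
open import Data.Product using (Σ; ∃; _×_)
open import Relation.Binary.PropositionalEquality using (_≡_)

-- Vectors of ℤ₂ⁿ are  Vec Bool n  (false = 0, true = 1); addition is xor.
_⊕_ : ∀ {n} → Vec Bool n → Vec Bool n → Vec Bool n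
_⊕_ = zipWith _xor_

𝟎 : ∀ {n} → Vec Bool n
𝟎 = replicate _ false

lincomb : ∀ {n d} → Vec Bool d → Vec (Vec Bool n) d → Vec Bool n
lincomb [] [] = 𝟎
lincomb (false ∷ c) (_ ∷ b) = lincomb c b
lincomb (true ∷ c) (v ∷ b) = v ⊕ lincomb c b

-- A subset V ⊆ ℤ₂ⁿ (given as a predicate) is a linear subspace
-- (over ℤ₂ scalar multiplication is trivial, so closure under + and 0 suffices).
record IsSubspace {n : ℕ} (V : Vec Bool n → Set) : Set where
  field
    zero-mem : V 𝟎
    add-mem  : ∀ {x y} → V x → V y → V (x ⊕ y)

data AllIn {n : ℕ} (V : Vec Bool n → Set) : ∀ {d} → Vec (Vec Bool n) d → Set where
  []  : AllIn V []
  _∷_ : ∀ {d v} {b : Vec (Vec Bool n) d} → V v → AllIn V b → AllIn V (v ∷ b)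

record IsBasis {n d : ℕ} (V : Vec Bool n → Set) (b : Vec (Vec Bool n) d) : Set where
  field
    members : AllIn V b
    spans   : ∀ v → V v → ∃ λ (c : Vec Bool d) → lincomb c b ≡ v
    indep   : ∀ (c : Vec Bool d) → lincomb c b ≡ 𝟎 → c ≡ replicate d false

HasDim : ∀ {n} → (Vec Bool n → Set) → ℕ → Set
HasDim {n} V d = Σ (Vec (Vec Bool n) d) (IsBasis V)

{-# OPTIONS --safe #-}
module Submission where

-- A d-dimensional subspace of ℤ₂ⁿ has covering radius at most n − d: Gaussian
-- elimination on the first coordinate either finds a pivot (the dimension drops by
-- one and the pivot row fixes that coordinate of the target) or not (the coordinate
-- costs at most one unit of distance). Applied to the all-ones target this gives
-- x ∈ V with at most n − d ≤ 2 zero coordinates, and surjectivity of the coordinate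
-- projections yields y ∈ V that is 1 on both of them: if y₁, y₂ ∈ V satisfy
-- y₁ i = 1 and y₂ j = 1, one of y₁, y₂, y₁ ⊕ y₂ is 1 at both i and j.

open import Defs
open import Algebra.Bundles using (CommutativeSemigroup)
open import Algebra.Definitions using (Associative; Commutative; LeftIdentity; RightIdentity; Interchangable)
import Algebra.Properties.CommutativeSemigroup as CommutativeSemigroupProperties
open import Data.Bool using (Bool; true; false; _xor_)
open import Data.Bool.Properties using (xor-assoc; xor-comm; xor-identityˡ; xor-identityʳ; xor-same)
open import Data.Fin using (Fin; zero; suc)
open import Data.Fin.Subset using (∣_∣)
open import Data.List using (List; []; _∷_; length)
import Data.List as List
open import Data.List.Properties using (length-map)
open import Data.List.Membership.Propositional using (_∈_)
open import Data.List.Membership.Propositional.Properties using (∈-map⁺)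
open import Data.List.Relation.Unary.All as All using (All; []; _∷_)
open import Data.List.Relation.Unary.Any using (here; there)
open import Data.Nat using (ℕ; zero; suc; _≤_; _+_; z≤n; s≤s)
open import Data.Nat.Properties using (+-suc; +-cancelˡ-≤; ≤-trans; m≤n⇒m≤1+n)
open import Data.Product using (∃; ∃₂; _×_; _,_)
open import Data.Vec using (Vec; []; _∷_; lookup; replicate; map; head; tail)
open import Data.Vec.Properties
  using (zipWith-assoc; zipWith-comm; zipWith-identityˡ; zipWith-identityʳ; lookup-zipWith)
open import Function using (case_of_)
open import Level using (0ℓ)
open import Relation.Binary.PropositionalEquality
  using (_≡_; refl; sym; trans; cong; cong₂; subst; module ≡-Reasoning)
open import Relation.Binary.PropositionalEquality.Algebra using (isMagma)
open import Relation.Nullary using (¬_)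

open ≡-Reasoning

private variable
  m n d d′ : ℕ

⊕-assoc : Associative _≡_ (_⊕_ {n})
⊕-assoc = zipWith-assoc xor-assoc

⊕-comm : Commutative _≡_ (_⊕_ {n})
⊕-comm = zipWith-comm xor-comm

⊕-identityˡ : LeftIdentity _≡_ 𝟎 (_⊕_ {n})
⊕-identityˡ = zipWith-identityˡ xor-identityˡ

⊕-identityʳ : RightIdentity _≡_ 𝟎 (_⊕_ {n})
⊕-identityʳ = zipWith-identityʳ xor-identityʳ

⊕-self : (x : Vec Bool n) → x ⊕ x ≡ 𝟎
⊕-self []      = refl
⊕-self (a ∷ x) = cong₂ _∷_ (xor-same a) (⊕-self x)

⊕-commutativeSemigroup : ℕ → CommutativeSemigroup 0ℓ 0ℓ
⊕-commutativeSemigroup n = record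
  { Carrier                = Vec Bool n
  ; _≈_                    = _≡_
  ; _∙_                    = _⊕_
  ; isCommutativeSemigroup = record
    { isSemigroup = record { isMagma = isMagma _⊕_ ; assoc = ⊕-assoc }
    ; comm        = ⊕-comm
    }
  }

⊕-interchange : Interchangable _≡_ (_⊕_ {n}) _⊕_
⊕-interchange {n} = CommutativeSemigroupProperties.interchange (⊕-commutativeSemigroup n)

lookup-⊕ : (i : Fin n) (x y : Vec Bool n) → lookup (x ⊕ y) i ≡ lookup x i xor lookup y i
lookup-⊕ i = lookup-zipWith _xor_ i

infixr 25 _·_

_·_ : Bool → Vec Bool n → Vec Bool n
true  · v = v
false · v = 𝟎

·-distribʳ-xor : ∀ a b (v : Vec Bool n) → (a xor b) · v ≡ a · v ⊕ b · v
·-distribʳ-xor true  true  v = sym (⊕-self v)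
·-distribʳ-xor true  false v = sym (⊕-identityʳ v)
·-distribʳ-xor false b     v = sym (⊕-identityˡ (b · v))

lincomb-∷ : ∀ a (c : Vec Bool d) v (b : Vec (Vec Bool n) d) →
            lincomb (a ∷ c) (v ∷ b) ≡ a · v ⊕ lincomb c b
lincomb-∷ true  c v b = refl
lincomb-∷ false c v b = sym (⊕-identityˡ (lincomb c b))

lincomb-zeroˡ : (b : Vec (Vec Bool n) d) → lincomb (replicate d false) b ≡ 𝟎
lincomb-zeroˡ []      = refl
lincomb-zeroˡ (_ ∷ b) = lincomb-zeroˡ b

lincomb-⊕ : (c c′ : Vec Bool d) (b : Vec (Vec Bool n) d) →
            lincomb (c ⊕ c′) b ≡ lincomb c b ⊕ lincomb c′ b
lincomb-⊕ [] [] [] = sym (⊕-identityʳ 𝟎)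
lincomb-⊕ (a ∷ c) (a′ ∷ c′) (v ∷ b) = begin
  lincomb ((a xor a′) ∷ (c ⊕ c′)) (v ∷ b)
    ≡⟨ lincomb-∷ (a xor a′) (c ⊕ c′) v b ⟩
  (a xor a′) · v ⊕ lincomb (c ⊕ c′) b
    ≡⟨ cong₂ _⊕_ (·-distribʳ-xor a a′ v) (lincomb-⊕ c c′ b) ⟩
  (a · v ⊕ a′ · v) ⊕ (lincomb c b ⊕ lincomb c′ b)
    ≡⟨ ⊕-interchange (a · v) (a′ · v) (lincomb c b) (lincomb c′ b) ⟩
  (a · v ⊕ lincomb c b) ⊕ (a′ · v ⊕ lincomb c′ b)
    ≡⟨ sym (cong₂ _⊕_ (lincomb-∷ a c v b) (lincomb-∷ a′ c′ v b)) ⟩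
  lincomb (a ∷ c) (v ∷ b) ⊕ lincomb (a′ ∷ c′) (v ∷ b)
    ∎

lincomb-map : (f : Vec Bool m → Vec Bool n) → f 𝟎 ≡ 𝟎 → (∀ x y → f (x ⊕ y) ≡ f x ⊕ f y) →
              (c : Vec Bool d) (b : Vec (Vec Bool m) d) → lincomb c (map f b) ≡ f (lincomb c b)
lincomb-map f f-𝟎 f-⊕ []          []      = sym f-𝟎
lincomb-map f f-𝟎 f-⊕ (false ∷ c) (_ ∷ b) = lincomb-map f f-𝟎 f-⊕ c b
lincomb-map f f-𝟎 f-⊕ (true ∷ c)  (v ∷ b) =
  trans (cong (f v ⊕_) (lincomb-map f f-𝟎 f-⊕ c b)) (sym (f-⊕ v (lincomb c b)))

lincomb-closed : {V : Vec Bool n → Set} {b : Vec (Vec Bool n) d} →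
                 IsSubspace V → AllIn V b → (c : Vec Bool d) → V (lincomb c b)
lincomb-closed V-sub []          []          = IsSubspace.zero-mem V-sub
lincomb-closed V-sub (_ ∷ b∈V)   (false ∷ c) = lincomb-closed V-sub b∈V c
lincomb-closed V-sub (v∈V ∷ b∈V) (true ∷ c)  = IsSubspace.add-mem V-sub v∈V (lincomb-closed V-sub b∈V c)

Independent : Vec (Vec Bool n) d → Set
Independent {d = d} b = ∀ c → lincomb c b ≡ 𝟎 → c ≡ replicate d false

-- The span of b′ lies in the code spanned by b, shortened at its first coordinate.
record Shortening (b : Vec (Vec Bool (suc n)) d) (b′ : Vec (Vec Bool n) d′) : Set where
  field
    lift               : Vec Bool d′ → Vec Bool d
    lincomb-lift       : ∀ c → lincomb (lift c) b ≡ false ∷ lincomb c b′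
    lift-reflects-zero : ∀ c → lift c ≡ replicate d false → c ≡ replicate d′ false

  independent : Independent b → Independent b′
  independent indep c b′c≡𝟎 =
    lift-reflects-zero c (indep (lift c) (trans (lincomb-lift c) (cong (false ∷_) b′c≡𝟎)))

open Shortening

shortening-[] : Shortening {n = n} [] []
shortening-[] = record
  { lift               = λ c → c
  ; lincomb-lift       = λ { [] → refl }
  ; lift-reflects-zero = λ _ c≡𝟎 → c≡𝟎
  }

shortening-∷ : {b : Vec (Vec Bool (suc n)) d} {b′ : Vec (Vec Bool n) d′} (v : Vec Bool n) →
               Shortening b b′ → Shortening ((false ∷ v) ∷ b) (v ∷ b′)
shortening-∷ {d = d} {d′ = d′} {b = b} {b′} v s = record
  { lift               = lift′
  ; lincomb-lift       = lincomb-lift′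
  ; lift-reflects-zero = lift′-reflects-zero
  }
  where
  lift′ : Vec Bool (suc d′) → Vec Bool (suc d)
  lift′ (a ∷ c) = a ∷ lift s c

  lincomb-lift′ : ∀ c → lincomb (lift′ c) ((false ∷ v) ∷ b) ≡ false ∷ lincomb c (v ∷ b′)
  lincomb-lift′ (true ∷ c)  = cong ((false ∷ v) ⊕_) (lincomb-lift s c)
  lincomb-lift′ (false ∷ c) = lincomb-lift s c

  lift′-reflects-zero : ∀ c → lift′ c ≡ replicate (suc d) false → c ≡ replicate (suc d′) false
  lift′-reflects-zero (a ∷ c) ac≡𝟎 =
    cong₂ _∷_ (cong head ac≡𝟎) (lift-reflects-zero s c (cong tail ac≡𝟎))

eliminate : Vec Bool n → Vec Bool (suc n) → Vec Bool n
eliminate v w = tail w ⊕ head w · v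

eliminate-𝟎 : (v : Vec Bool n) → eliminate v 𝟎 ≡ 𝟎
eliminate-𝟎 v = ⊕-identityʳ 𝟎

eliminate-⊕ : (v : Vec Bool n) (x y : Vec Bool (suc n)) →
              eliminate v (x ⊕ y) ≡ eliminate v x ⊕ eliminate v y
eliminate-⊕ v (a ∷ x) (b ∷ y) =
  trans (cong ((x ⊕ y) ⊕_) (·-distribʳ-xor a b v)) (⊕-interchange x y (a · v) (b · v))

pivot-eliminates : (v : Vec Bool n) (w : Vec Bool (suc n)) →
                   head w · (true ∷ v) ⊕ w ≡ false ∷ eliminate v w
pivot-eliminates v (true ∷ w)  = cong (false ∷_) (⊕-comm v w)
pivot-eliminates v (false ∷ w) = cong (false ∷_) (trans (⊕-identityˡ w) (sym (⊕-identityʳ w)))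

shortening-pivot : (v : Vec Bool n) (b : Vec (Vec Bool (suc n)) d) →
                   Shortening ((true ∷ v) ∷ b) (map (eliminate v) b)
shortening-pivot v b = record
  { lift               = λ c → head (lincomb c b) ∷ c
  ; lincomb-lift       = lincomb-lift′
  ; lift-reflects-zero = λ _ → cong tail
  }
  where
  lincomb-lift′ : ∀ c → lincomb (head (lincomb c b) ∷ c) ((true ∷ v) ∷ b) ≡
                        false ∷ lincomb c (map (eliminate v) b)
  lincomb-lift′ c = begin
    lincomb (head (lincomb c b) ∷ c) ((true ∷ v) ∷ b)
      ≡⟨ lincomb-∷ (head (lincomb c b)) c (true ∷ v) b ⟩
    head (lincomb c b) · (true ∷ v) ⊕ lincomb c b
      ≡⟨ pivot-eliminates v (lincomb c b) ⟩
    false ∷ eliminate v (lincomb c b)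
      ≡⟨ cong (false ∷_) (sym (lincomb-map (eliminate v) (eliminate-𝟎 v) (eliminate-⊕ v) c b)) ⟩
    false ∷ lincomb c (map (eliminate v) b)
      ∎

data FirstColumn : Vec (Vec Bool (suc n)) d → Set where
  zero-column : {b : Vec (Vec Bool (suc n)) d} (b′ : Vec (Vec Bool n) d) →
                Shortening b b′ → FirstColumn b
  pivot       : {b : Vec (Vec Bool (suc n)) (suc d)} (b′ : Vec (Vec Bool n) d) →
                Shortening b b′ → (c : Vec Bool (suc d)) (p : Vec Bool n) → lincomb c b ≡ true ∷ p →
                FirstColumn b

firstColumn : (b : Vec (Vec Bool (suc n)) d) → FirstColumn b
firstColumn [] = zero-column [] shortening-[]
firstColumn ((true ∷ v) ∷ b) =
  pivot (map (eliminate v) b) (shortening-pivot v b) (true ∷ replicate _ false) v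
        (trans (cong ((true ∷ v) ⊕_) (lincomb-zeroˡ b)) (⊕-identityʳ (true ∷ v)))
firstColumn ((false ∷ v) ∷ b) with firstColumn b
... | zero-column b′ s   = zero-column (v ∷ b′) (shortening-∷ v s)
... | pivot b′ s c p b-c = pivot (v ∷ b′) (shortening-∷ v s) (false ∷ c) p b-c

+-∣∷∣-≤ : ∀ a (w : Vec Bool n) → d + ∣ w ∣ ≤ n → d + ∣ a ∷ w ∣ ≤ suc n
+-∣∷∣-≤ false w bound = m≤n⇒m≤1+n bound
+-∣∷∣-≤ {n = n} {d = d} true w bound = subst (_≤ suc n) (sym (+-suc d ∣ w ∣)) (s≤s bound)

-- ∣_∣ counts true entries, so ∣ x ⊕ t ∣ is the Hamming distance between x and t.
covering-radius-bound : {b : Vec (Vec Bool n) d} → Independent b →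
                        (t : Vec Bool n) → ∃ λ c → d + ∣ lincomb c b ⊕ t ∣ ≤ n
covering-radius-bound {n = zero} {d = zero}  {[]} _ [] = [] , z≤n
covering-radius-bound {n = zero} {d = suc d} {b} indep []
  with lincomb (true ∷ replicate d false) b in b-c
... | [] = case indep (true ∷ replicate d false) b-c of λ ()
covering-radius-bound {n = suc n} {d} {b} indep (t₀ ∷ t) with firstColumn b | t₀
... | zero-column b′ s | a
  with c , bound ← covering-radius-bound (independent s indep) t
  = lift s c , subst (λ x → d + ∣ x ⊕ (a ∷ t) ∣ ≤ suc n) (sym (lincomb-lift s c))
                      (+-∣∷∣-≤ a (lincomb c b′ ⊕ t) bound)
... | pivot b′ s _ _ _ | false
  with c , bound ← covering-radius-bound (independent s indep) t
  = lift s c , subst (λ x → d + ∣ x ⊕ (false ∷ t) ∣ ≤ suc n) (sym (lincomb-lift s c)) (s≤s bound)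
... | pivot {d = d′} b′ s c₁ p b-c₁ | true
  with c , bound ← covering-radius-bound (independent s indep) (p ⊕ t)
  = lift s c ⊕ c₁ , subst (λ x → suc d′ + ∣ x ∣ ≤ suc n) (sym move-to-target) (s≤s bound)
  where
  move-to-target : lincomb (lift s c ⊕ c₁) b ⊕ (true ∷ t) ≡ false ∷ (lincomb c b′ ⊕ (p ⊕ t))
  move-to-target = begin
    lincomb (lift s c ⊕ c₁) b ⊕ (true ∷ t)
      ≡⟨ cong (_⊕ (true ∷ t)) (lincomb-⊕ (lift s c) c₁ b) ⟩
    (lincomb (lift s c) b ⊕ lincomb c₁ b) ⊕ (true ∷ t)
      ≡⟨ cong (_⊕ (true ∷ t)) (cong₂ _⊕_ (lincomb-lift s c) b-c₁) ⟩
    false ∷ ((lincomb c b′ ⊕ p) ⊕ t)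
      ≡⟨ cong (false ∷_) (⊕-assoc (lincomb c b′) p t) ⟩
    false ∷ (lincomb c b′ ⊕ (p ⊕ t))
      ∎

zeros : Vec Bool n → List (Fin n)
zeros []          = []
zeros (true ∷ x)  = List.map suc (zeros x)
zeros (false ∷ x) = zero ∷ List.map suc (zeros x)

length-zeros : (x : Vec Bool n) → length (zeros x) ≡ ∣ x ⊕ replicate n true ∣
length-zeros []          = refl
length-zeros (true ∷ x)  = trans (length-map suc (zeros x)) (length-zeros x)
length-zeros (false ∷ x) = cong suc (trans (length-map suc (zeros x)) (length-zeros x))

∈-zeros : (x : Vec Bool n) (k : Fin n) → lookup x k ≡ false → k ∈ zeros x
∈-zeros (false ∷ x) zero    _  = here refl
∈-zeros (false ∷ x) (suc k) xₖ = there (∈-map⁺ suc (∈-zeros x k xₖ))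
∈-zeros (true ∷ x)  (suc k) xₖ = ∈-map⁺ suc (∈-zeros x k xₖ)

module _ {V : Vec Bool n → Set} (V-sub : IsSubspace V)
         (onto : ∀ (i : Fin n) (a : Bool) → ∃ λ v → V v × lookup v i ≡ a) where

  covers-pair : (i j : Fin n) → ∃ λ y → V y × lookup y i ≡ true × lookup y j ≡ true
  covers-pair i j with onto i true | onto j true
  ... | y₁ , y₁∈V , y₁ᵢ | y₂ , y₂∈V , y₂ⱼ with lookup y₁ j in y₁ⱼ | lookup y₂ i in y₂ᵢ
  ...   | true  | _     = y₁ , y₁∈V , y₁ᵢ , y₁ⱼ
  ...   | false | true  = y₂ , y₂∈V , y₂ᵢ , y₂ⱼ
  ...   | false | false =
    y₁ ⊕ y₂ , IsSubspace.add-mem V-sub y₁∈V y₂∈V ,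
    trans (lookup-⊕ i y₁ y₂) (cong₂ _xor_ y₁ᵢ y₂ᵢ) ,
    trans (lookup-⊕ j y₁ y₂) (cong₂ _xor_ y₁ⱼ y₂ⱼ)

  covers-≤2 : (L : List (Fin n)) → length L ≤ 2 → ∃ λ y → V y × All (λ k → lookup y k ≡ true) L
  covers-≤2 []           _ = 𝟎 , IsSubspace.zero-mem V-sub , []
  covers-≤2 (i ∷ [])     _ with y , y∈V , yᵢ ← onto i true = y , y∈V , yᵢ ∷ []
  covers-≤2 (i ∷ j ∷ []) _ with y , y∈V , yᵢ , yⱼ ← covers-pair i j = y , y∈V , yᵢ ∷ yⱼ ∷ []
  covers-≤2 (_ ∷ _ ∷ _ ∷ _) (s≤s (s≤s ()))

lemma5p6 : (n d : ℕ) (V : Vec Bool n → Set) → IsSubspace V → HasDim V d →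
    n ≤ d + 2 → d ≤ n →
    (∀ (i : Fin n) (a : Bool) → ∃ λ v → V v × lookup v i ≡ a) →
    ∃₂ λ x y → V x × V y ×
    (∀ (i : Fin n) → ¬ (lookup x i ≡ false × lookup y i ≡ false))
lemma5p6 n d V V-sub (b , basis) n≤d+2 _ onto
  with c , close ← covering-radius-bound (IsBasis.indep basis) (replicate n true)
  with y , y∈V , y-covers ← covers-≤2 V-sub onto (zeros (lincomb c b))
         (subst (_≤ 2) (sym (length-zeros (lincomb c b))) (+-cancelˡ-≤ d _ 2 (≤-trans close n≤d+2)))
  = lincomb c b , y , lincomb-closed V-sub (IsBasis.members basis) c , y∈V , no-common-zero
  where
  no-common-zero : ∀ i → ¬ (lookup (lincomb c b) i ≡ false × lookup y i ≡ false)
  no-common-zero i (xᵢ≡0 , yᵢ≡0) =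
    case trans (sym (All.lookup y-covers (∈-zeros (lincomb c b) i xᵢ≡0))) yᵢ≡0 of λ ()
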